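{- For every finite multiset $\Gamma$ of formulas and every formula $E$: $\Gamma\Rightarrow E$ is derivable in $\mathsf{GWFC}$ if and only if $\vdash_{\mathsf{WFC}}\bigwedge\Gamma\rightarrow E$.
   Context: Formulas are built from a countable set of propositional atoms and $\bot$ using $\wedge,\vee,\rightarrow$; $A\leftrightarrow B$ abbreviates $(A\rightarrow B)\wedge(B\rightarrow A)$. $\bigwedge\Gamma$ is the conjunction of the formulas of $\Gamma$ (empty conjunction read as $\bot\rightarrow\bot$). Sequent calculus $\mathsf{GWFC}$ (sequents $\Gamma\Rightarrow C$, $\Gamma$ finite multiset, $C$ a formula, $p$ atomic): (Ax) $p,\Gamma\Rightarrow p$; ($\bot_L$) $\bot,\Gamma\Rightarrow C$; ($\wedge_L$) from $A,B,\Gamma\Rightarrow C$ infer $A\wedge B,\Gamma\Rightarrow C$; ($\wedge_R$) from $\Gamma\Rightarrow A$ and $\Gamma\Rightarrow B$ infer $\Gamma\Rightarrow A\wedge B$; ($\vee_L$) from $A,\Gamma\Rightarrow C$ and $B,\Gamma\Rightarrow C$ infer $A\vee B,\Gamma\Rightarrow C$; ($\vee_R^1$) from $\Gamma\Rightarrow A$ infer $\Gamma\Rightarrow A\vee B$; ($\vee_R^2$) from $\Gamma\Rightarrow B$ infer $\Gamma\Rightarrow A\vee B$; ($\rightarrow_R$) from $A\Rightarrow B$ infer $\Gamma\Rightarrow A\rightarrow B$; ($\rightarrow_{LR}$) from $A\Rightarrow B$, $B\Rightarrow A$, $C\Rightarrow D$, $D\Rightarrow C$ infer $\Gamma,A\rightarrow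 C\Rightarrow B\rightarrow D$; ($\rightarrow_C$) from $\Gamma\Rightarrow B\rightarrow C$ and $\Gamma\Rightarrow B\rightarrow D$ infer $\Gamma\Rightarrow B\rightarrow C\wedge D$; (Cut) from $\Gamma\Rightarrow D$ and $D,\Gamma'\Rightarrow E$ infer $\Gamma,\Gamma'\Rightarrow E$. Hilbert system $\mathsf{WF}$: axioms all instances of $A\rightarrow(A\vee B)$; $B\rightarrow(A\vee B)$; $(A\wedge B)\rightarrow A$; $(A\wedge B)\rightarrow B$; $A\wedge(B\vee C)\rightarrow(A\wedge B)\vee(A\wedge C)$; $A\rightarrow A$; $\bot\rightarrow A$; rules: from $A$, $A\rightarrow B$ infer $B$; from $A$ infer $B\rightarrow A$; from $A\rightarrow B$, $B\rightarrow C$ infer $A\rightarrow C$; from $A\rightarrow B$, $A\rightarrow C$ infer $A\rightarrow(B\wedge C)$; from $A\rightarrow C$, $B\rightarrow C$ infer $(A\vee B)\rightarrow C$; from $A$, $B$ infer $A\wedge B$; from $A\leftrightarrow B$, $C\leftrightarrow D$ infer $(A\rightarrow C)\leftrightarrow(B\rightarrow D)$. $\mathsf{WFC}$ is $\mathsf{WF}$ plus all instances of the axiom $(A\rightarrow B)\wedge(A\rightarrow C)\rightarrow(A\rightarrow B\wedge C)$. -}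

module Defs where

open import Data.Nat using (ℕ)
open import Data.List using (List; []; _∷_; _++_)
open import Data.List.Relation.Binary.Permutation.Propositional using (_↭_)

infixr 30 _∧_
infixr 25 _∨_
infixr 20 _⇒_

data Fm : Set where
  atom : ℕ → Fm
  ⊥'   : Fm
  _∧_  : Fm → Fm → Fm
  _∨_  : Fm → Fm → Fm
  _⇒_  : Fm → Fm → Fm

_⇔_ : Fm → Fm → Fm
A ⇔ B = (A ⇒ B) ∧ (B ⇒ A)

⋀ : List Fm → Fm
⋀ []          = ⊥' ⇒ ⊥'
⋀ (A ∷ [])    = A
⋀ (A ∷ B ∷ Γ) = A ∧ ⋀ (B ∷ Γ)

-- Antecedents are finite multisets, represented
-- as lists taken up to permutation: a rule whose conclusion antecedent is
-- written "A, Γ" (or "Γ, Γ'") applies to any list Δ that is a permutation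
-- of it.
data GWFC : List Fm → Fm → Set where
  ax   : ∀ {Δ Γ} p → Δ ↭ atom p ∷ Γ → GWFC Δ (atom p)
  ⊥L   : ∀ {Δ Γ C} → Δ ↭ ⊥' ∷ Γ → GWFC Δ C
  ∧L   : ∀ {Δ Γ A B C} → Δ ↭ (A ∧ B) ∷ Γ → GWFC (A ∷ B ∷ Γ) C → GWFC Δ C
  ∧R   : ∀ {Γ A B} → GWFC Γ A → GWFC Γ B → GWFC Γ (A ∧ B)
  ∨L   : ∀ {Δ Γ A B C} → Δ ↭ (A ∨ B) ∷ Γ →
         GWFC (A ∷ Γ) C → GWFC (B ∷ Γ) C → GWFC Δ C
  ∨R1  : ∀ {Γ A B} → GWFC Γ A → GWFC Γ (A ∨ B)
  ∨R2  : ∀ {Γ A B} → GWFC Γ B → GWFC Γ (A ∨ B)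
  ⇒R   : ∀ {Γ A B} → GWFC (A ∷ []) B → GWFC Γ (A ⇒ B)
  ⇒LR  : ∀ {Δ Γ A B C D} → Δ ↭ (A ⇒ C) ∷ Γ →
         GWFC (A ∷ []) B → GWFC (B ∷ []) A →
         GWFC (C ∷ []) D → GWFC (D ∷ []) C → GWFC Δ (B ⇒ D)
  ⇒C   : ∀ {Γ B C D} → GWFC Γ (B ⇒ C) → GWFC Γ (B ⇒ D) → GWFC Γ (B ⇒ (C ∧ D))
  cut  : ∀ {Δ Γ Γ' D E} → Δ ↭ Γ ++ Γ' →
         GWFC Γ D → GWFC (D ∷ Γ') E → GWFC Δ E

data WFC⊢ : Fm → Set where
  ax∨1   : ∀ A B → WFC⊢ (A ⇒ A ∨ B)
  ax∨2   : ∀ A B → WFC⊢ (B ⇒ A ∨ B)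
  ax∧1   : ∀ A B → WFC⊢ (A ∧ B ⇒ A)
  ax∧2   : ∀ A B → WFC⊢ (A ∧ B ⇒ B)
  axDist : ∀ A B C → WFC⊢ (A ∧ (B ∨ C) ⇒ (A ∧ B) ∨ (A ∧ C))
  axId   : ∀ A → WFC⊢ (A ⇒ A)
  ax⊥    : ∀ A → WFC⊢ (⊥' ⇒ A)
  axC    : ∀ A B C → WFC⊢ ((A ⇒ B) ∧ (A ⇒ C) ⇒ (A ⇒ B ∧ C))
  mp     : ∀ {A B} → WFC⊢ A → WFC⊢ (A ⇒ B) → WFC⊢ B
  wk     : ∀ {A} B → WFC⊢ A → WFC⊢ (B ⇒ A)
  trans  : ∀ {A B C} → WFC⊢ (A ⇒ B) → WFC⊢ (B ⇒ C) → WFC⊢ (A ⇒ C)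
  conjR  : ∀ {A B C} → WFC⊢ (A ⇒ B) → WFC⊢ (A ⇒ C) → WFC⊢ (A ⇒ B ∧ C)
  disjL  : ∀ {A B C} → WFC⊢ (A ⇒ C) → WFC⊢ (B ⇒ C) → WFC⊢ (A ∨ B ⇒ C)
  adj    : ∀ {A B} → WFC⊢ A → WFC⊢ B → WFC⊢ (A ∧ B)
  cong⇒  : ∀ {A B C D} → WFC⊢ (A ⇔ B) → WFC⊢ (C ⇔ D) →
           WFC⊢ ((A ⇒ C) ⇔ (B ⇒ D))

{-# OPTIONS --safe #-}
-- Soundness: if X entails in WFC every formula of Γ and Γ ⇒ C is derivable, then X entails C;
-- quantifying over X, not just X = ⋀ Γ, is what handles the single-formula premises of ⇒R and ⇒LR.
-- Completeness: every axiom and rule of WFC is derivable in GWFC over the empty antecedent.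
-- Rules whose premises are implications need the sequent A ⇒ B from the sequent ⇒ A → B.
-- This inversion comes without cut elimination from a realizability interpretation: an implication
-- A → B is realized by a derivation of A ⇒ B, atoms and ⊥ are never realized, and every rule of
-- GWFC, cut included, preserves realizability.
module Submission where

open import Defs
open import Data.Empty using (⊥)
open import Data.List using (List; []; _∷_; [_]; _++_)
open import Data.List.Properties using (++-identityʳ)
open import Data.List.Membership.Propositional using (_∈_)
open import Data.List.Membership.Propositional.Properties using (∈-∃++)
open import Data.List.Relation.Binary.Permutation.Propositional
  using (_↭_; refl; swap; trans; ↭-sym; ↭-reflexive)
open import Data.List.Relation.Binary.Permutation.Propositional.Properties
  using (All-resp-↭; shift)
open import Data.List.Relation.Unary.All as All using (All; []; _∷_)
open import Data.List.Relation.Unary.All.Properties using (++⁻)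
open import Data.List.Relation.Unary.Any using (here; there)
open import Data.Product using (_×_; _,_)
open import Data.Sum using (_⊎_; inj₁; inj₂)
open import Relation.Binary.PropositionalEquality using (refl; sym)

_≤_ : Fm → Fm → Set
X ≤ Y = WFC⊢ (X ⇒ Y)

⋀-elim : ∀ Γ → All (⋀ Γ ≤_) Γ
⋀-elim []          = []
⋀-elim (A ∷ [])    = axId A ∷ []
⋀-elim (A ∷ B ∷ Γ) =
  ax∧1 A (⋀ (B ∷ Γ)) ∷ All.map (trans (ax∧2 A (⋀ (B ∷ Γ)))) (⋀-elim (B ∷ Γ))

mutual
  sound : ∀ {X Γ E} → GWFC Γ E → All (X ≤_) Γ → X ≤ E
  sound (ax p π) xs with x ∷ _ ← All-resp-↭ π xs = x
  sound (⊥L π)   xs with x ∷ _ ← All-resp-↭ π xs = trans x (ax⊥ _)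
  sound (∧L {A = A} {B} π d) xs with x ∷ xs′ ← All-resp-↭ π xs =
    sound d (trans x (ax∧1 A B) ∷ trans x (ax∧2 A B) ∷ xs′)
  sound (∧R d e) xs = conjR (sound d xs) (sound e xs)
  sound {X} (∨L {A = A} {B} π d e) xs with x ∷ xs′ ← All-resp-↭ π xs =
    trans (conjR (axId X) x)
      (trans (axDist X A B)
        (disjL (sound d (ax∧2 X A ∷ All.map (trans (ax∧1 X A)) xs′))
               (sound e (ax∧2 X B ∷ All.map (trans (ax∧1 X B)) xs′))))
  sound (∨R1 {A = A} {B} d) xs = trans (sound d xs) (ax∨1 A B)
  sound (∨R2 {A = A} {B} d) xs = trans (sound d xs) (ax∨2 A B)
  sound {X} (⇒R d) _ = wk X (sound-⇒ d)
  sound (⇒LR π a b c d) xs with x ∷ _ ← All-resp-↭ π xs =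
    trans x (mp (cong⇒ (adj (sound-⇒ a) (sound-⇒ b)) (adj (sound-⇒ c) (sound-⇒ d)))
                (ax∧1 _ _))
  sound (⇒C {B = B} {C} {D} d e) xs = trans (conjR (sound d xs) (sound e xs)) (axC B C D)
  sound (cut {Γ = Γ} π d e) xs with ys , zs ← ++⁻ Γ (All-resp-↭ π xs) =
    sound e (sound d ys ∷ zs)

  sound-⇒ : ∀ {A B} → GWFC [ A ] B → A ≤ B
  sound-⇒ {A} d = sound d (axId A ∷ [])

exchange : ∀ {Δ Δ′ C} → Δ ↭ Δ′ → GWFC Δ C → GWFC Δ′ C
exchange σ (ax p π)          = ax p (trans (↭-sym σ) π)
exchange σ (⊥L π)            = ⊥L (trans (↭-sym σ) π)
exchange σ (∧L π d)          = ∧L (trans (↭-sym σ) π) d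
exchange σ (∧R d e)          = ∧R (exchange σ d) (exchange σ e)
exchange σ (∨L π d e)        = ∨L (trans (↭-sym σ) π) d e
exchange σ (∨R1 d)           = ∨R1 (exchange σ d)
exchange σ (∨R2 d)           = ∨R2 (exchange σ d)
exchange σ (⇒R d)            = ⇒R d
exchange σ (⇒LR π a b c d)   = ⇒LR (trans (↭-sym σ) π) a b c d
exchange σ (⇒C d e)          = ⇒C (exchange σ d) (exchange σ e)
exchange σ (cut π d e)       = cut (trans (↭-sym σ) π) d e

identity : ∀ A Γ → GWFC (A ∷ Γ) A
identity (atom p) Γ = ax p refl
identity ⊥'       Γ = ⊥L refl
identity (A ∧ B)  Γ =
  ∧L refl (∧R (identity A (B ∷ Γ)) (exchange (swap B A refl) (identity B (A ∷ Γ))))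
identity (A ∨ B)  Γ = ∨L refl (∨R1 (identity A Γ)) (∨R2 (identity B Γ))
identity (A ⇒ B)  Γ = ⇒LR refl (identity A []) (identity A []) (identity B []) (identity B [])

assumption : ∀ {G Γ} → G ∈ Γ → GWFC Γ G
assumption {G} m with ys , zs , refl ← ∈-∃++ m =
  exchange (↭-sym (shift G ys zs)) (identity G (ys ++ zs))

⋀R : ∀ {Γ} L → All (GWFC Γ) L → GWFC Γ (⋀ L)
⋀R []          []       = ⇒R (⊥L refl)
⋀R (_ ∷ [])    (d ∷ []) = d
⋀R (_ ∷ B ∷ L) (d ∷ ds) = ∧R d (⋀R (B ∷ L) ds)

⋀L : ∀ {Γ E} → GWFC [ ⋀ Γ ] E → GWFC Γ E
⋀L {Γ} = cut (↭-reflexive (sym (++-identityʳ Γ))) (⋀R Γ (All.tabulate assumption))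

compose : ∀ {A B C} → GWFC [ A ] B → GWFC [ B ] C → GWFC [ A ] C
compose = cut refl

⟦_⟧ : Fm → Set
⟦ atom p ⟧ = ⊥
⟦ ⊥' ⟧     = ⊥
⟦ A ∧ B ⟧  = ⟦ A ⟧ × ⟦ B ⟧
⟦ A ∨ B ⟧  = ⟦ A ⟧ ⊎ ⟦ B ⟧
⟦ A ⇒ B ⟧  = GWFC [ A ] B

realize : ∀ {Γ E} → GWFC Γ E → All ⟦_⟧ Γ → ⟦ E ⟧
realize (ax p π) rs with () ∷ _ ← All-resp-↭ π rs
realize (⊥L π)   rs with () ∷ _ ← All-resp-↭ π rs
realize (∧L π d) rs with (a , b) ∷ rs′ ← All-resp-↭ π rs = realize d (a ∷ b ∷ rs′)
realize (∧R d e) rs = realize d rs , realize e rs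
realize (∨L π d e) rs with All-resp-↭ π rs
... | inj₁ a ∷ rs′ = realize d (a ∷ rs′)
... | inj₂ b ∷ rs′ = realize e (b ∷ rs′)
realize (∨R1 d) rs = inj₁ (realize d rs)
realize (∨R2 d) rs = inj₂ (realize d rs)
realize (⇒R d) _ = d
realize (⇒LR π a b c d) rs with f ∷ _ ← All-resp-↭ π rs = compose b (compose f c)
realize (⇒C d e) rs = ∧R (realize d rs) (realize e rs)
realize (cut {Γ = Γ} π d e) rs with ys , zs ← ++⁻ Γ (All-resp-↭ π rs) =
  realize e (realize d ys ∷ zs)

⇒-inversion : ∀ {A B} → GWFC [] (A ⇒ B) → GWFC [ A ] B
⇒-inversion d = realize d []

⇔-inversion : ∀ {A B} → GWFC [] (A ⇔ B) → GWFC [ A ] B × GWFC [ B ] A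
⇔-inversion d = realize d []

mutual
  complete : ∀ {F} → WFC⊢ F → GWFC [] F
  complete (ax∨1 A B)     = ⇒R (∨R1 (identity A []))
  complete (ax∨2 A B)     = ⇒R (∨R2 (identity B []))
  complete (ax∧1 A B)     = ⇒R (∧L refl (identity A [ B ]))
  complete (ax∧2 A B)     = ⇒R (∧L refl (assumption (there (here refl))))
  complete (axDist A B C) = ⇒R (∧L refl (∨L (swap A (B ∨ C) refl)
    (∨R1 (∧R (assumption (there (here refl))) (identity B [ A ])))
    (∨R2 (∧R (assumption (there (here refl))) (identity C [ A ])))))
  complete (axId A)       = ⇒R (identity A [])
  complete (ax⊥ A)        = ⇒R (⊥L refl)
  complete (axC A B C)    =
    ⇒R (∧L refl (⇒C (identity (A ⇒ B) [ A ⇒ C ]) (assumption (there (here refl)))))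
  complete (mp d e)       = cut refl (complete d) (complete-⇒ e)
  complete (wk B d)       = ⇒R (cut refl (complete d) (identity _ [ B ]))
  complete (trans d e)    = ⇒R (compose (complete-⇒ d) (complete-⇒ e))
  complete (conjR d e)    = ⇒R (∧R (complete-⇒ d) (complete-⇒ e))
  complete (disjL d e)    = ⇒R (∨L refl (complete-⇒ d) (complete-⇒ e))
  complete (adj d e)      = ∧R (complete d) (complete e)
  complete (cong⇒ d e)
    with ab , ba ← ⇔-inversion (complete d) | cd , dc ← ⇔-inversion (complete e) =
    ∧R (⇒R (⇒LR refl ab ba cd dc)) (⇒R (⇒LR refl ba ab dc cd))

  complete-⇒ : ∀ {A B} → WFC⊢ (A ⇒ B) → GWFC [ A ] B
  complete-⇒ d = ⇒-inversion (complete d)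

mainTheorem13 : (Γ : List Fm) (E : Fm) →
    (GWFC Γ E → WFC⊢ (⋀ Γ ⇒ E)) × (WFC⊢ (⋀ Γ ⇒ E) → GWFC Γ E)
mainTheorem13 Γ E = (λ d → sound d (⋀-elim Γ)) , (λ h → ⋀L (complete-⇒ h))
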